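{- Let $n \ge 1$ and let $\alpha, \beta, \gamma, \theta \in \mathbb{F}_{3^n}^*$. Define $f: \mathbb{F}_{3^n} \to \mathbb{F}_{3^n}$ by $$f(x) = \begin{cases} 0 & \text{if } x = 0, \\ \alpha(x^3 + \gamma x^2 + \gamma^2 x) & \text{if } x \in C_0, \\ \beta(x^3 + \theta x^2 + \theta^2 x) & \text{if } x \in C_1. \end{cases}$$ Suppose $f$ is a permutation of $\mathbb{F}_{3^n}$ and $\eta(\alpha) = (-1)^m$ with $m \in \{0,1\}$. Then the inverse of $f$ on $\mathbb{F}_{3^n}$ is $$f^{ -1}(x) = -u(x)\left(1 + (-1)^m x^{(3^n-1)/2}\right) - v(x)\left(1 + (-1)^{m+1} x^{(3^n-1)/2}\right),$$ where $$u(x) = \sum_{0 \le j,k \le n-1} \gamma \left(\alpha^{ -1}\gamma^{ -3} x\right)^{\frac{3^j+3^k}{2}}, \qquad v(x) = \sum_{0 \le j,k \le n-1} \theta \left(\beta^{ -1}\theta^{ -3} x\right)^{\frac{3^j+3^k}{2}}.$$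
   Context: $C_0 = \{e^2 : e \in \mathbb{F}_{3^n}^*\}$ is the set of nonzero squares and $C_1 = \mathbb{F}_{3^n}^* \setminus C_0$. $\eta$ denotes the quadratic character of $\mathbb{F}_{3^n}$: $\eta(a) = 1$ if $a \in C_0$ and $\eta(a) = -1$ if $a \in C_1$. The inverse of $f$ is a polynomial $g \in \mathbb{F}_{3^n}[x]$ with $g(f(c)) = c$ for all $c \in \mathbb{F}_{3^n}$. It is known that such $f$ is a permutation if and only if $\eta(\gamma) = -1$, $\eta(\theta) = 1$ and $\eta(\alpha) = \eta(\beta)$. -}

module Defs where

open import Level using (0ℓ)
open import Data.Nat using (ℕ; zero; suc) renaming (_+_ to _+ℕ_; _^_ to _^ℕ_)
open import Data.Fin using (Fin)
open import Data.List using (List; map; foldr; upTo; concatMap)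
open import Data.Product using (Σ; ∃; _×_; _,_)
open import Data.Sum using (_⊎_)
open import Relation.Nullary using (¬_; Dec)
open import Relation.Binary.PropositionalEquality using (_≡_; _≢_)
open import Algebra.Structures using (IsCommutativeRing)
open import Function.Bundles using (_↔_)

-- A finite field with exactly 3^n elements (equality is propositional).
-- Any field of order 3^n is (isomorphic to) F_{3^n}.
record FiniteField3 (n : ℕ) : Set₁ where
  infixl 7 _*_
  infixl 6 _+_
  field
    Carrier : Set
    _+_ _*_ : Carrier → Carrier → Carrier
    -_ : Carrier → Carrier
    0# 1# : Carrier
    isCommutativeRing : IsCommutativeRing _≡_ _+_ _*_ -_ 0# 1#
    0≢1 : 0# ≢ 1#
    _⁻¹ : Carrier → Carrier
    inverseʳ : ∀ x → x ≢ 0# → x * (x ⁻¹) ≡ 1#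
    _≟_ : (x y : Carrier) → Dec (x ≡ y)
    card : Fin (3 ^ℕ n) ↔ Carrier

  pow : Carrier → ℕ → Carrier
  pow x zero = 1#
  pow x (suc k) = x * pow x k

  C₀ : Carrier → Set
  C₀ a = Σ Carrier λ e → (e ≢ 0#) × (e * e ≡ a)

  C₁ : Carrier → Set
  C₁ a = (a ≢ 0#) × ¬ C₀ a

  -- η a ≡ s  (quadratic character, for nonzero a)
  HasEta : Carrier → Carrier → Set
  HasEta a s = (C₀ a × s ≡ 1#) ⊎ (C₁ a × s ≡ - 1#)

  sumL : List Carrier → Carrier
  sumL = foldr _+_ 0#

  sum2 : (ℕ → ℕ → Carrier) → Carrier
  sum2 F = sumL (concatMap (λ j → map (λ k → F j k) (upTo n)) (upTo n))

-- Since x³ + γx² + γ²x = x(x − γ)² in characteristic 3, f multiplies the quadratic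
-- character η x = x^((3ⁿ−1)/2) by η(α) on C₀ and by −η(β) on C₁ (Euler's criterion is
-- proved by pairing y with a/y in the product of all nonzero elements). Injectivity and
-- surjectivity of f then force η(γ) = −1, η(θ) = 1 and η(β) = η(α), so the factors
-- 1 ± (−1)^m x^((3ⁿ−1)/2) select u on f(C₀) and v on f(C₁). For x ∈ C₀ put z = x/γ: then
-- α⁻¹γ⁻³ f(x) = z(z − 1)² and η(z) = −1. With A(j,k) = z^((3^j+3^k)/2), the Frobenius
-- identity (z − 1)^(3^j) = z^(3^j) − 1 turns (z(z − 1)²)^((3^j+3^k)/2) into the mixed
-- difference A(j+1,k+1) − A(j,k+1) − A(j+1,k) + A(j,k), so the double sum defining u
-- telescopes to A(n,n) − A(0,n) − A(n,0) + A(0,0) = z + z + z + z = z, i.e. u(f(x)) = γz = x.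
-- Symmetrically v(f(x)) = x on C₁.
module Submission where

open import Level using (0ℓ)
open import Algebra.Bundles using (CommutativeRing; CommutativeSemigroup; RawRing)
open import Algebra.Bundles.Raw using (RawMonoid)
open import Algebra.Core using (Op₂)
open import Algebra.Structures using (IsCommutativeMonoid)
import Algebra.Properties.AbelianGroup as AbelianGroupProperties
import Algebra.Properties.CommutativeSemigroup as CommutativeSemigroupProperties
import Algebra.Properties.Group as GroupProperties
import Algebra.Properties.Ring as RingProperties
import Algebra.Properties.Semiring.Mult as SemiringMultiplication
open import Algebra.Solver.Ring.AlmostCommutativeRing
  using (fromCommutativeRing; _-Raw-AlmostCommutative⟶_)
open import Data.Maybe using (Maybe; just; nothing)
open import Data.Nat using (ℕ; zero; suc; _≤_; _∸_) renaming (_+_ to _+ℕ_; _*_ to _*ℕ_; _^_ to _^ℕ_)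
import Data.Nat.Properties as ℕ
open import Data.Nat.DivMod using (_/_; m*n/n≡m)
open import Data.Nat.Tactic.RingSolver using (solve-∀)
open import Data.Product using (∃; _×_; _,_; proj₁; proj₂)
open import Data.Sum using (_⊎_; inj₁; inj₂)
open import Data.List using (List; []; _∷_; _++_; foldr; length; map; concat; allFin; applyUpTo; upTo)
open import Data.List.Properties using (length-map; length-tabulate; map-applyUpTo; map-∘)
open import Data.List.Membership.Propositional using (_∈_; lose)
open import Data.List.Membership.Propositional.Properties using (∈-∃++; ∈-allFin; ∈-map⁺)
open import Data.List.Membership.Propositional.Properties.WithK using (unique∧set⇒bag)
import Data.List.Relation.Unary.Any as Any
open import Data.List.Relation.Unary.Any using (here; there)
import Data.List.Relation.Unary.All as All
open import Data.List.Relation.Unary.Unique.Propositional using (Unique; _∷_)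
import Data.List.Relation.Unary.Unique.Propositional.Properties as Unique
open import Data.List.Relation.Binary.BagAndSetEquality using (∼bag⇒↭)
open import Data.List.Relation.Binary.Permutation.Propositional using (_↭_; ↭-sym; ↭⇒↭ₛ)
open import Data.List.Relation.Binary.Permutation.Propositional.Properties
  using (∈-resp-↭; ↭-length; shift)
import Data.List.Relation.Binary.Permutation.Setoid.Properties as SetoidPermutation
open import Function using (_∘_)
open import Function.Bundles using (Inverse; Injection; mk⇔)
open import Function.Definitions using (Bijective)
open import Function.Properties.Inverse using (Inverse⇒Injection)
open import Relation.Binary.PropositionalEquality
open import Relation.Nullary using (¬_; Dec; yes; no; ¬?; _×-dec_)
open import Relation.Nullary.Decidable using (map′)
open import Relation.Nullary.Negation using (contradiction)

open import Defs

data ℤ₃ : Set where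
  0₃ 1₃ -1₃ : ℤ₃

_+₃_ : ℤ₃ → ℤ₃ → ℤ₃
0₃  +₃ y   = y
x   +₃ 0₃  = x
1₃  +₃ 1₃  = -1₃
1₃  +₃ -1₃ = 0₃
-1₃ +₃ 1₃  = 0₃
-1₃ +₃ -1₃ = 1₃

_*₃_ : ℤ₃ → ℤ₃ → ℤ₃
0₃  *₃ y   = 0₃
1₃  *₃ y   = y
-1₃ *₃ 0₃  = 0₃
-1₃ *₃ 1₃  = -1₃
-1₃ *₃ -1₃ = 1₃

-₃_ : ℤ₃ → ℤ₃
-₃ 0₃  = 0₃
-₃ 1₃  = -1₃
-₃ -1₃ = 1₃

ℤ₃-rawRing : RawRing 0ℓ 0ℓ
ℤ₃-rawRing = record
  { Carrier = ℤ₃ ; _≈_ = _≡_ ; _+_ = _+₃_ ; _*_ = _*₃_ ; -_ = -₃_ ; 0# = 0₃ ; 1# = 1₃ }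

HasCharacteristic3 : ∀ {a ℓ} → CommutativeRing a ℓ → Set ℓ
HasCharacteristic3 R = 1# + (1# + 1#) ≈ 0#
  where open CommutativeRing R

module Characteristic3Solver {a ℓ} (R : CommutativeRing a ℓ) (1+1+1≈0 : HasCharacteristic3 R) where
  private
    module R = CommutativeRing R
    module G = GroupProperties R.+-group
    open R using (Carrier; _≈_; _+_; _*_; -_; 0#; 1#)
    open import Relation.Binary.Reasoning.Setoid R.setoid

    ⟦_⟧ : ℤ₃ → Carrier
    ⟦ 0₃ ⟧  = 0#
    ⟦ 1₃ ⟧  = 1#
    ⟦ -1₃ ⟧ = - 1#

    1+1≈-1 : 1# + 1# ≈ - 1#
    1+1≈-1 = G.inverseʳ-unique 1# (1# + 1#) 1+1+1≈0

    -1+-1≈1 : - 1# + - 1# ≈ 1#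
    -1+-1≈1 = begin
      - 1# + - 1#   ≈⟨ G.⁻¹-anti-homo-∙ 1# 1# ⟨
      - (1# + 1#)   ≈⟨ R.-‿cong 1+1≈-1 ⟩
      - (- 1#)      ≈⟨ G.⁻¹-involutive 1# ⟩
      1#            ∎

    +-homo : ∀ x y → ⟦ x +₃ y ⟧ ≈ ⟦ x ⟧ + ⟦ y ⟧
    +-homo 0₃  y   = R.sym (R.+-identityˡ _)
    +-homo 1₃  0₃  = R.sym (R.+-identityʳ _)
    +-homo -1₃ 0₃  = R.sym (R.+-identityʳ _)
    +-homo 1₃  1₃  = R.sym 1+1≈-1
    +-homo 1₃  -1₃ = R.sym (R.-‿inverseʳ 1#)
    +-homo -1₃ 1₃  = R.sym (R.-‿inverseˡ 1#)
    +-homo -1₃ -1₃ = R.sym -1+-1≈1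

    *-homo : ∀ x y → ⟦ x *₃ y ⟧ ≈ ⟦ x ⟧ * ⟦ y ⟧
    *-homo 0₃  y   = R.sym (R.zeroˡ _)
    *-homo 1₃  y   = R.sym (R.*-identityˡ _)
    *-homo -1₃ 0₃  = R.sym (R.zeroʳ _)
    *-homo -1₃ 1₃  = R.sym (R.*-identityʳ _)
    *-homo -1₃ -1₃ = R.sym (R.trans (RingProperties.-1*x≈-x R.ring (- 1#)) (G.⁻¹-involutive 1#))

    -‿homo : ∀ x → ⟦ -₃ x ⟧ ≈ - ⟦ x ⟧
    -‿homo 0₃  = R.sym G.ε⁻¹≈ε
    -‿homo 1₃  = R.refl
    -‿homo -1₃ = R.sym (G.⁻¹-involutive 1#)

    morphism : ℤ₃-rawRing -Raw-AlmostCommutative⟶ fromCommutativeRing R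
    morphism = record
      { ⟦_⟧ = ⟦_⟧ ; +-homo = +-homo ; *-homo = *-homo ; -‿homo = -‿homo
      ; 0-homo = R.refl ; 1-homo = R.refl }

    ⟦⟧-equal? : ∀ x y → Maybe (⟦ x ⟧ ≈ ⟦ y ⟧)
    ⟦⟧-equal? 0₃  0₃  = just R.refl
    ⟦⟧-equal? 1₃  1₃  = just R.refl
    ⟦⟧-equal? -1₃ -1₃ = just R.refl
    ⟦⟧-equal? _   _   = nothing

  open import Algebra.Solver.Ring ℤ₃-rawRing (fromCommutativeRing R) morphism ⟦⟧-equal? public

module _ {a} {A : Set a} where

  Unique-resp-↭ : ∀ {xs ys : List A} → xs ↭ ys → Unique xs → Unique ys
  Unique-resp-↭ p = SetoidPermutation.Unique-resp-↭ (setoid A) (↭⇒↭ₛ p)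

  ∈⇒↭∷ : ∀ {x : A} {xs} → x ∈ xs → ∃ λ ys → xs ↭ x ∷ ys
  ∈⇒↭∷ x∈xs with ys , zs , refl ← ∈-∃++ x∈xs = ys ++ zs , shift _ ys zs

  ∈-↭∷ : ∀ {x y : A} {xs ys} → xs ↭ x ∷ ys → y ∈ xs → y ≢ x → y ∈ ys
  ∈-↭∷ p y∈xs y≢x with ∈-resp-↭ p y∈xs
  ... | here y≡x   = contradiction y≡x y≢x
  ... | there y∈ys = y∈ys

  ∈-↭∷⁻ : ∀ {x y : A} {xs ys} → xs ↭ x ∷ ys → y ∈ ys → y ∈ xs
  ∈-↭∷⁻ p y∈ys = ∈-resp-↭ (↭-sym p) (there y∈ys)

  ∉-Unique∷ : ∀ {x y : A} {ys} → Unique (x ∷ ys) → y ∈ ys → y ≢ x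
  ∉-Unique∷ (x∉ys ∷ _) y∈ys y≡x = All.lookup x∉ys y∈ys (sym y≡x)

module ListFold {a} {A : Set a} {_∙_ : Op₂ A} {ε : A}
                (isCommutativeMonoid : IsCommutativeMonoid _≡_ _∙_ ε) where
  open IsCommutativeMonoid isCommutativeMonoid using (isCommutativeSemigroup; identityˡ; assoc)

  private
    commutativeSemigroup : CommutativeSemigroup a a
    commutativeSemigroup = record { isCommutativeSemigroup = isCommutativeSemigroup }

    rawMonoid : RawMonoid a a
    rawMonoid = record { Carrier = A ; _≈_ = _≡_ ; _∙_ = _∙_ ; ε = ε }

  open CommutativeSemigroupProperties commutativeSemigroup using (interchange)
  open import Algebra.Definitions.RawMonoid rawMonoid public
    using () renaming (_×_ to _times_)

  fold : List A → A
  fold = foldr _∙_ ε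

  fold-↭ : ∀ {xs ys} → xs ↭ ys → fold xs ≡ fold ys
  fold-↭ p = SetoidPermutation.foldr-commMonoid (setoid A) isCommutativeMonoid (↭⇒↭ₛ p)

  fold-Unique-cong : ∀ {xs ys} → Unique xs → Unique ys →
                     (∀ {x} → x ∈ xs → x ∈ ys) → (∀ {x} → x ∈ ys → x ∈ xs) → fold xs ≡ fold ys
  fold-Unique-cong uxs uys xs⊆ys ys⊆xs =
    fold-↭ (∼bag⇒↭ (unique∧set⇒bag uxs uys (mk⇔ xs⊆ys ys⊆xs)))

  fold-map-∙ : ∀ c xs → fold (map (_∙ c) xs) ≡ fold xs ∙ (length xs times c)
  fold-map-∙ c []       = sym (identityˡ ε)
  fold-map-∙ c (x ∷ xs) = trans (cong ((x ∙ c) ∙_) (fold-map-∙ c xs)) (interchange x c (fold xs) _)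

  fold-++ : ∀ xs ys → fold (xs ++ ys) ≡ fold xs ∙ fold ys
  fold-++ []       ys = sym (identityˡ _)
  fold-++ (x ∷ xs) ys = trans (cong (x ∙_) (fold-++ xs ys)) (sym (assoc _ _ _))

  fold-concat : ∀ xss → fold (concat xss) ≡ fold (map fold xss)
  fold-concat []         = refl
  fold-concat (xs ∷ xss) = trans (fold-++ xs (concat xss)) (cong (fold xs ∙_) (fold-concat xss))

  record PairedBy (ι : A → A) (p : A) (xs : List A) : Set a where
    field
      closed         : ∀ {x} → x ∈ xs → ι x ∈ xs
      involutive     : ∀ {x} → x ∈ xs → ι (ι x) ≡ x
      fixedPointFree : ∀ {x} → x ∈ xs → ι x ≢ x
      pairProduct    : ∀ {x} → x ∈ xs → x ∙ ι x ≡ p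

  module _ {ι : A → A} {p : A} where

    private
      partner∈ : ∀ {x xs} → PairedBy ι p (x ∷ xs) → ι x ∈ xs
      partner∈ P with PairedBy.closed P (here refl)
      ... | here ιx≡x   = contradiction ιx≡x (PairedBy.fixedPointFree P (here refl))
      ... | there ιx∈xs = ιx∈xs

      removePair : ∀ {x xs} → Unique (x ∷ xs) → PairedBy ι p (x ∷ xs) →
                   ∃ λ ys → xs ↭ ι x ∷ ys × Unique ys × PairedBy ι p ys
      removePair {x} {xs} uxxs@(_ ∷ uxs) P
        with ys , xs↭ ← ∈⇒↭∷ (partner∈ P)
        with _ ∷ uys ← Unique-resp-↭ xs↭ uxs =
        ys , xs↭ , uys , record
          { closed         = closed
          ; involutive     = λ y∈ys → P.involutive (sub y∈ys)
          ; fixedPointFree = λ y∈ys → P.fixedPointFree (sub y∈ys)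
          ; pairProduct    = λ y∈ys → P.pairProduct (sub y∈ys) }
        where
        module P = PairedBy P
        sub : ∀ {y} → y ∈ ys → y ∈ x ∷ xs
        sub y∈ys = there (∈-↭∷⁻ xs↭ y∈ys)
        closed : ∀ {y} → y ∈ ys → ι y ∈ ys
        closed {y} y∈ys with P.closed (sub y∈ys)
        ... | here ιy≡x = contradiction (trans (sym (P.involutive (sub y∈ys))) (cong ι ιy≡x))
                            (∉-Unique∷ (Unique-resp-↭ xs↭ uxs) y∈ys)
        ... | there ιy∈xs = ∈-↭∷ xs↭ ιy∈xs λ ιy≡ιx →
                  ∉-Unique∷ uxxs (∈-↭∷⁻ xs↭ y∈ys)
                    (trans (sym (P.involutive (sub y∈ys)))
                      (trans (cong ι ιy≡ιx) (P.involutive (here refl))))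

    fold-PairedBy : ∀ k {xs} → length xs ≡ k → Unique xs → PairedBy ι p xs →
                    ∃ λ m → k ≡ m +ℕ m × fold xs ≡ m times p
    fold-PairedBy zero          {[]}     _ _ _ = 0 , refl , refl
    fold-PairedBy (suc zero)    {x ∷ []} _ _ P with () ← partner∈ P
    fold-PairedBy (suc (suc k)) {x ∷ xs} len uxxs P
      with ys , xs↭ , uys , Pys ← removePair uxxs P
      with m , k≡m+m , fold-ys ← fold-PairedBy k (cong (_∸ 2) (trans (cong suc (sym (↭-length xs↭))) len)) uys Pys
      = suc m , cong suc (trans (cong suc k≡m+m) (sym (ℕ.+-suc m m))) , fold-xxs
      where
      fold-xxs : x ∙ fold xs ≡ p ∙ (m times p)
      fold-xxs = begin
        x ∙ fold xs          ≡⟨ cong (x ∙_) (fold-↭ xs↭) ⟩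
        x ∙ (ι x ∙ fold ys)  ≡⟨ assoc _ _ _ ⟨
        (x ∙ ι x) ∙ fold ys  ≡⟨ cong₂ _∙_ (PairedBy.pairProduct P (here refl)) fold-ys ⟩
        p ∙ (m times p)      ∎
        where open ≡-Reasoning

[m+m]/2≡m : ∀ m → (m +ℕ m) / 2 ≡ m
[m+m]/2≡m m = trans (cong (λ k → (m +ℕ k) / 2) (sym (ℕ.+-identityʳ m)))
                    (trans (cong (_/ 2) (ℕ.*-comm 2 m)) (m*n/n≡m m 2))

⌊3^_/2⌋ : ℕ → ℕ
⌊3^ zero  /2⌋ = 0
⌊3^ suc j /2⌋ = suc (3 *ℕ ⌊3^ j /2⌋)

3^j≡1+2⌊3^j/2⌋ : ∀ j → 3 ^ℕ j ≡ suc (⌊3^ j /2⌋ +ℕ ⌊3^ j /2⌋)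
3^j≡1+2⌊3^j/2⌋ zero    = refl
3^j≡1+2⌊3^j/2⌋ (suc j) = trans (cong (3 *ℕ_) (3^j≡1+2⌊3^j/2⌋ j)) (lemma ⌊3^ j /2⌋)
  where
  lemma : ∀ a → 3 *ℕ suc (a +ℕ a) ≡ suc (suc (3 *ℕ a) +ℕ suc (3 *ℕ a))
  lemma = solve-∀

[3^n∸1]/2≡⌊3^n/2⌋ : ∀ n → (3 ^ℕ n ∸ 1) / 2 ≡ ⌊3^ n /2⌋
[3^n∸1]/2≡⌊3^n/2⌋ n = trans (cong (λ x → (x ∸ 1) / 2) (3^j≡1+2⌊3^j/2⌋ n)) ([m+m]/2≡m _)

exponent : ℕ → ℕ → ℕ
exponent j k = suc (⌊3^ j /2⌋ +ℕ ⌊3^ k /2⌋)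

exponent+exponent : ∀ j k → exponent j k +ℕ exponent j k ≡ 3 ^ℕ j +ℕ 3 ^ℕ k
exponent+exponent j k = trans (lemma ⌊3^ j /2⌋ ⌊3^ k /2⌋)
                              (sym (cong₂ _+ℕ_ (3^j≡1+2⌊3^j/2⌋ j) (3^j≡1+2⌊3^j/2⌋ k)))
  where
  lemma : ∀ a b → suc (a +ℕ b) +ℕ suc (a +ℕ b) ≡ suc (a +ℕ a) +ℕ suc (b +ℕ b)
  lemma = solve-∀

[3^j+3^k]/2≡exponent : ∀ j k → (3 ^ℕ j +ℕ 3 ^ℕ k) / 2 ≡ exponent j k
[3^j+3^k]/2≡exponent j k =
  trans (cong (_/ 2) (sym (exponent+exponent j k))) ([m+m]/2≡m (exponent j k))

exponent-sucˡ : ∀ j k → exponent (suc j) k ≡ exponent j k +ℕ 3 ^ℕ j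
exponent-sucˡ j k = trans (lemma ⌊3^ j /2⌋ ⌊3^ k /2⌋) (cong (exponent j k +ℕ_) (sym (3^j≡1+2⌊3^j/2⌋ j)))
  where
  lemma : ∀ a b → suc (suc (3 *ℕ a) +ℕ b) ≡ suc (a +ℕ b) +ℕ suc (a +ℕ a)
  lemma = solve-∀

exponent-sucʳ : ∀ j k → exponent j (suc k) ≡ exponent j k +ℕ 3 ^ℕ k
exponent-sucʳ j k = trans (lemma ⌊3^ j /2⌋ ⌊3^ k /2⌋) (cong (exponent j k +ℕ_) (sym (3^j≡1+2⌊3^j/2⌋ k)))
  where
  lemma : ∀ a b → suc (a +ℕ suc (3 *ℕ b)) ≡ suc (a +ℕ b) +ℕ suc (b +ℕ b)
  lemma = solve-∀

module FieldProperties {n : ℕ} (F : FiniteField3 n) where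
  open FiniteField3 F

  commutativeRing : CommutativeRing 0ℓ 0ℓ
  commutativeRing = record { isCommutativeRing = isCommutativeRing }

  open CommutativeRing commutativeRing public
    using ( +-identityˡ; +-identityʳ; *-identityˡ; *-identityʳ; zeroˡ; zeroʳ; *-assoc; *-comm
          ; -‿inverseʳ; distribˡ; +-isCommutativeMonoid; *-isCommutativeMonoid )
  module +G = AbelianGroupProperties (CommutativeRing.+-abelianGroup commutativeRing)
  open CommutativeSemigroupProperties (CommutativeRing.*-commutativeSemigroup commutativeRing)
    using () renaming (interchange to *-interchange)
  module Sum = ListFold +-isCommutativeMonoid
  module Product = ListFold *-isCommutativeMonoid

  inverseˡ : ∀ x → x ≢ 0# → x ⁻¹ * x ≡ 1#
  inverseˡ x x≢0 = trans (*-comm _ x) (inverseʳ x x≢0)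

  x*y≡0⇒y≡0 : ∀ {x y} → x ≢ 0# → x * y ≡ 0# → y ≡ 0#
  x*y≡0⇒y≡0 {x} {y} x≢0 xy≡0 = begin
    y               ≡⟨ sym (*-identityˡ y) ⟩
    1# * y          ≡⟨ cong (_* y) (sym (inverseˡ x x≢0)) ⟩
    (x ⁻¹ * x) * y  ≡⟨ *-assoc _ _ _ ⟩
    x ⁻¹ * (x * y)  ≡⟨ cong (x ⁻¹ *_) xy≡0 ⟩
    x ⁻¹ * 0#       ≡⟨ zeroʳ _ ⟩
    0#              ∎
    where open ≡-Reasoning

  *-≢0 : ∀ {x y} → x ≢ 0# → y ≢ 0# → x * y ≢ 0#
  *-≢0 x≢0 y≢0 xy≡0 = y≢0 (x*y≡0⇒y≡0 x≢0 xy≡0)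

  ⁻¹-≢0 : ∀ {x} → x ≢ 0# → x ⁻¹ ≢ 0#
  ⁻¹-≢0 {x} x≢0 x⁻¹≡0 = 0≢1 (trans (sym (zeroʳ x)) (trans (cong (x *_) (sym x⁻¹≡0)) (inverseʳ x x≢0)))

  ⁻¹-unique : ∀ {x y} → x ≢ 0# → x * y ≡ 1# → y ≡ x ⁻¹
  ⁻¹-unique {x} {y} x≢0 xy≡1 = begin
    y               ≡⟨ sym (*-identityˡ y) ⟩
    1# * y          ≡⟨ cong (_* y) (sym (inverseˡ x x≢0)) ⟩
    (x ⁻¹ * x) * y  ≡⟨ *-assoc _ _ _ ⟩
    x ⁻¹ * (x * y)  ≡⟨ cong (x ⁻¹ *_) xy≡1 ⟩
    x ⁻¹ * 1#       ≡⟨ *-identityʳ _ ⟩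
    x ⁻¹            ∎
    where open ≡-Reasoning

  pow-≢0 : ∀ {x} k → x ≢ 0# → pow x k ≢ 0#
  pow-≢0 zero    _   = 0≢1 ∘ sym
  pow-≢0 (suc k) x≢0 = *-≢0 x≢0 (pow-≢0 k x≢0)

  pow-+ : ∀ x j k → pow x (j +ℕ k) ≡ pow x j * pow x k
  pow-+ x zero    k = sym (*-identityˡ _)
  pow-+ x (suc j) k = trans (cong (x *_) (pow-+ x j k)) (sym (*-assoc _ _ _))

  pow-distrib-* : ∀ x y k → pow (x * y) k ≡ pow x k * pow y k
  pow-distrib-* x y zero    = sym (*-identityˡ 1#)
  pow-distrib-* x y (suc k) = trans (cong ((x * y) *_) (pow-distrib-* x y k)) (*-interchange x y _ _)

  pow-1# : ∀ k → pow 1# k ≡ 1#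
  pow-1# zero    = refl
  pow-1# (suc k) = trans (*-identityˡ _) (pow-1# k)

  times≡pow : ∀ k x → k Product.times x ≡ pow x k
  times≡pow zero    x = refl
  times≡pow (suc k) x = cong (x *_) (times≡pow k x)

  elements : List Carrier
  elements = map (Inverse.to card) (allFin (3 ^ℕ n))

  ∈-elements : ∀ x → x ∈ elements
  ∈-elements x = subst (_∈ elements) (Inverse.strictlyInverseˡ card x)
                   (∈-map⁺ (Inverse.to card) (∈-allFin (Inverse.from card x)))

  elements-Unique : Unique elements
  elements-Unique = Unique.map⁺ (Injection.injective (Inverse⇒Injection card)) (Unique.allFin⁺ _)

  length-elements : length elements ≡ 3 ^ℕ n
  length-elements =
    trans (length-map (Inverse.to card) (allFin _)) (length-tabulate {n = 3 ^ℕ n} (λ i → i))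

  private
    module Mult = SemiringMultiplication (CommutativeRing.semiring commutativeRing)

    -- x ↦ x + 1 permutes the field, so adding 1 to each element leaves the total unchanged.
    order×1≡0 : (3 ^ℕ n) Sum.times 1# ≡ 0#
    order×1≡0 = +G.identityʳ-unique (sumL elements) _ (begin
      sumL elements + (3 ^ℕ n) Sum.times 1#         ≡⟨ cong (λ k → sumL elements + k Sum.times 1#) (sym length-elements) ⟩
      sumL elements + length elements Sum.times 1#  ≡⟨ Sum.fold-map-∙ 1# elements ⟨
      sumL (map (_+ 1#) elements)                   ≡⟨ Sum.fold-Unique-cong shifted-Unique elements-Unique
                                                         (λ {x} _ → ∈-elements x) ∈-shifted ⟩
      sumL elements                                 ∎)
      where
      open ≡-Reasoning
      shifted-Unique : Unique (map (_+ 1#) elements)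
      shifted-Unique = Unique.map⁺ (λ {x} {y} → +G.∙-cancelʳ 1# x y) elements-Unique
      ∈-shifted : ∀ {x} → x ∈ elements → x ∈ map (_+ 1#) elements
      ∈-shifted {x} _ = subst (_∈ map (_+ 1#) elements) (+G.//-rightDividesˡ 1# x)
                          (∈-map⁺ (_+ 1#) (∈-elements (x + - 1#)))

    power×1 : ∀ k → (3 ^ℕ k) Sum.times 1# ≡ pow (3 Sum.times 1#) k
    power×1 zero    = +-identityʳ 1#
    power×1 (suc k) = trans (Mult.×1-homo-* 3 (3 ^ℕ k)) (cong ((3 Sum.times 1#) *_) (power×1 k))

  1+1+1≡0 : 1# + (1# + 1#) ≡ 0#
  1+1+1≡0 with (3 Sum.times 1#) ≟ 0#
  ... | yes 3×1≡0 = trans (cong (λ x → 1# + (1# + x)) (sym (+-identityʳ 1#))) 3×1≡0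
  ... | no  3×1≢0 = contradiction (trans (sym (power×1 n)) order×1≡0) (pow-≢0 n 3×1≢0)

module EulerCriterion {n : ℕ} (F : FiniteField3 n) where
  open FiniteField3 F
  open FieldProperties F
  open Characteristic3Solver commutativeRing 1+1+1≡0

  h : ℕ
  h = (3 ^ℕ n ∸ 1) / 2

  η : Carrier → Carrier
  η x = pow x h

  η-* : ∀ x y → η (x * y) ≡ η x * η y
  η-* x y = pow-distrib-* x y h

  y-e≡0⇒y≡e : ∀ {y e} → y + - e ≡ 0# → y ≡ e
  y-e≡0⇒y≡e = +G.x∙y⁻¹≈ε⇒x≈y _ _

  -x≢x : ∀ {x} → x ≢ 0# → - x ≢ x
  -x≢x {x} x≢0 -x≡x = x≢0 (begin
    x              ≡⟨ solve 1 (λ x → x := x :+ (x :+ (:- x))) refl x ⟩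
    x + (x + - x)  ≡⟨ cong (λ y → x + (x + y)) -x≡x ⟩
    x + (x + x)    ≡⟨ solve 1 (λ x → x :+ (x :+ x) := con 0₃) refl x ⟩
    0#             ∎)
    where open ≡-Reasoning

  -≢0 : ∀ {x} → x ≢ 0# → - x ≢ 0#
  -≢0 x≢0 -x≡0 = x≢0 (trans (sym (+G.⁻¹-involutive _)) (trans (cong -_ -x≡0) +G.ε⁻¹≈ε))

  square-roots : ∀ y e → y * y ≡ e * e → y ≡ e ⊎ y ≡ - e
  square-roots y e y²≡e² with (y + - e) ≟ 0#
  ... | yes y-e≡0 = inj₁ (y-e≡0⇒y≡e y-e≡0)
  ... | no  y-e≢0 = inj₂ (y-e≡0⇒y≡e (trans (cong (y +_) (+G.⁻¹-involutive e)) (x*y≡0⇒y≡0 y-e≢0 (begin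
    (y + - e) * (y + e)  ≡⟨ solve 2 (λ y e → (y :- e) :* (y :+ e) := (y :* y) :- (e :* e)) refl y e ⟩
    y * y + - (e * e)    ≡⟨ cong (_+ - (e * e)) y²≡e² ⟩
    e * e + - (e * e)    ≡⟨ -‿inverseʳ _ ⟩
    0#                   ∎))))
    where open ≡-Reasoning

  private
    removed0 : ∃ λ ys → elements ↭ 0# ∷ ys
    removed0 = ∈⇒↭∷ (∈-elements 0#)

  nonzeros : List Carrier
  nonzeros = proj₁ removed0

  nonzeros-Unique : Unique nonzeros
  nonzeros-Unique with _ ∷ u ← Unique-resp-↭ (proj₂ removed0) elements-Unique = u

  ∈-nonzeros : ∀ {x} → x ≢ 0# → x ∈ nonzeros
  ∈-nonzeros x≢0 = ∈-↭∷ (proj₂ removed0) (∈-elements _) x≢0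

  nonzeros-≢0 : ∀ {x} → x ∈ nonzeros → x ≢ 0#
  nonzeros-≢0 = ∉-Unique∷ (Unique-resp-↭ (proj₂ removed0) elements-Unique)

  length-nonzeros : length nonzeros ≡ 3 ^ℕ n ∸ 1
  length-nonzeros = cong (_∸ 1) (trans (sym (↭-length (proj₂ removed0))) length-elements)

  private
    h≡ : ∀ {k m} → length nonzeros ≡ k → k ≡ m +ℕ m → h ≡ m
    h≡ {k} {m} len k≡m+m = trans (cong (_/ 2) (trans (sym length-nonzeros) (trans len k≡m+m))) ([m+m]/2≡m m)

  -- Pairing y with a/y in the product of all nonzero elements: there is no fixed point
  -- when a is a non-square, and exactly the two fixed points ±e when a = e².
  module PairingWith (a : Carrier) (a≢0 : a ≢ 0#) where
    ι : Carrier → Carrier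
    ι y = a * y ⁻¹

    ι-≢0 : ∀ {y} → y ≢ 0# → ι y ≢ 0#
    ι-≢0 y≢0 = *-≢0 a≢0 (⁻¹-≢0 y≢0)

    y*ιy≡a : ∀ {y} → y ≢ 0# → y * ι y ≡ a
    y*ιy≡a {y} y≢0 = trans (solve 3 (λ a y y⁻¹ → y :* (a :* y⁻¹) := a :* (y :* y⁻¹)) refl a y (y ⁻¹))
                       (trans (cong (a *_) (inverseʳ y y≢0)) (*-identityʳ a))

    ι-involutive : ∀ {y} → y ≢ 0# → ι (ι y) ≡ y
    ι-involutive {y} y≢0 = begin
      a * (ι y) ⁻¹   ≡⟨ cong (a *_) (sym (⁻¹-unique (ι-≢0 y≢0) ιy*[a⁻¹*y]≡1)) ⟩
      a * (a ⁻¹ * y) ≡⟨ sym (*-assoc _ _ _) ⟩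
      (a * a ⁻¹) * y ≡⟨ cong (_* y) (inverseʳ a a≢0) ⟩
      1# * y         ≡⟨ *-identityˡ y ⟩
      y              ∎
      where
      open ≡-Reasoning
      ιy*[a⁻¹*y]≡1 : ι y * (a ⁻¹ * y) ≡ 1#
      ιy*[a⁻¹*y]≡1 = begin
        (a * y ⁻¹) * (a ⁻¹ * y)   ≡⟨ solve 4 (λ a a⁻¹ y y⁻¹ → (a :* y⁻¹) :* (a⁻¹ :* y) := (a :* a⁻¹) :* (y :* y⁻¹))
                                             refl a (a ⁻¹) y (y ⁻¹) ⟩
        (a * a ⁻¹) * (y * y ⁻¹)   ≡⟨ cong₂ _*_ (inverseʳ a a≢0) (inverseʳ y y≢0) ⟩
        1# * 1#                   ≡⟨ *-identityˡ 1# ⟩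
        1#                        ∎

    y*y≡a⇒ιy≡y : ∀ {y} → y ≢ 0# → y * y ≡ a → ι y ≡ y
    y*y≡a⇒ιy≡y {y} y≢0 y²≡a = begin
      a * y ⁻¹        ≡⟨ cong (_* y ⁻¹) (sym y²≡a) ⟩
      y * y * y ⁻¹    ≡⟨ *-assoc _ _ _ ⟩
      y * (y * y ⁻¹)  ≡⟨ cong (y *_) (inverseʳ y y≢0) ⟩
      y * 1#          ≡⟨ *-identityʳ y ⟩
      y               ∎
      where open ≡-Reasoning

    ιy≢root : ∀ {y r} → y ≢ 0# → r ≢ 0# → r * r ≡ a → y ≢ r → ι y ≢ r
    ιy≢root y≢0 r≢0 r²≡a y≢r ιy≡r =
      y≢r (trans (sym (ι-involutive y≢0)) (trans (cong ι ιy≡r) (y*y≡a⇒ιy≡y r≢0 r²≡a)))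

    ιy≡y⇒y*y≡a : ∀ {y} → y ≢ 0# → ι y ≡ y → y * y ≡ a
    ιy≡y⇒y*y≡a {y} y≢0 ιy≡y = trans (cong (y *_) (sym ιy≡y)) (y*ιy≡a y≢0)

    pairedBy-ι : ∀ {xs} → (∀ {y} → y ∈ xs → y ≢ 0#) → (∀ {y} → y ∈ xs → ι y ∈ xs) →
                 (∀ {y} → y ∈ xs → y * y ≢ a) → Product.PairedBy ι a xs
    pairedBy-ι ≢0 closed non-root = record
      { closed         = closed
      ; involutive     = λ y∈xs → ι-involutive (≢0 y∈xs)
      ; fixedPointFree = λ y∈xs ιy≡y → non-root y∈xs (ιy≡y⇒y*y≡a (≢0 y∈xs) ιy≡y)
      ; pairProduct    = λ y∈xs → y*ιy≡a (≢0 y∈xs) }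

    private
      removeRoots : ∀ {e R₁ R₂} → e ≢ 0# → e * e ≡ a → nonzeros ↭ e ∷ R₁ → R₁ ↭ - e ∷ R₂ →
                    Unique R₂ × Product.PairedBy ι a R₂
      removeRoots {e} {R₁} {R₂} e≢0 e²≡a nonzeros↭ R₁↭
        with _ ∷ uR₁ ← Unique-resp-↭ nonzeros↭ nonzeros-Unique
        with _ ∷ uR₂ ← Unique-resp-↭ R₁↭ uR₁
        = uR₂ , pairedBy-ι ≢0 closed non-root
        where
        ≢0 : ∀ {y} → y ∈ R₂ → y ≢ 0#
        ≢0 y∈ = nonzeros-≢0 (∈-↭∷⁻ nonzeros↭ (∈-↭∷⁻ R₁↭ y∈))
        ≢e : ∀ {y} → y ∈ R₂ → y ≢ e
        ≢e y∈ = ∉-Unique∷ (Unique-resp-↭ nonzeros↭ nonzeros-Unique) (∈-↭∷⁻ R₁↭ y∈)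
        ≢-e : ∀ {y} → y ∈ R₂ → y ≢ - e
        ≢-e y∈ = ∉-Unique∷ (Unique-resp-↭ R₁↭ uR₁) y∈
        non-root : ∀ {y} → y ∈ R₂ → y * y ≢ a
        non-root {y} y∈ y²≡a with square-roots y e (trans y²≡a (sym e²≡a))
        ... | inj₁ y≡e  = ≢e y∈ y≡e
        ... | inj₂ y≡-e = ≢-e y∈ y≡-e
        closed : ∀ {y} → y ∈ R₂ → ι y ∈ R₂
        closed y∈ = ∈-↭∷ R₁↭
          (∈-↭∷ nonzeros↭ (∈-nonzeros (ι-≢0 (≢0 y∈))) (ιy≢root (≢0 y∈) e≢0 e²≡a (≢e y∈)))
          (ιy≢root (≢0 y∈) (-≢0 e≢0) (trans (solve 1 (λ e → :- e :* :- e := e :* e) refl e) e²≡a) (≢-e y∈))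

    product-nonzeros-nonsquare : ¬ C₀ a → Product.fold nonzeros ≡ pow a h
    product-nonzeros-nonsquare a∉C₀
      with m , len≡m+m , Π≡ ← Product.fold-PairedBy _ refl nonzeros-Unique
             (pairedBy-ι nonzeros-≢0 (λ y∈ → ∈-nonzeros (ι-≢0 (nonzeros-≢0 y∈)))
                         (λ {y} y∈ y²≡a → a∉C₀ (y , nonzeros-≢0 y∈ , y²≡a)))
      = trans Π≡ (trans (times≡pow m a) (cong (pow a) (sym (h≡ {m = m} refl len≡m+m))))

    product-nonzeros-square : ∀ {e} → e ≢ 0# → e * e ≡ a → Product.fold nonzeros ≡ - pow a h
    product-nonzeros-square {e} e≢0 e²≡a
      with R₁ , nonzeros↭ ← ∈⇒↭∷ (∈-nonzeros e≢0)
      with R₂ , R₁↭ ← ∈⇒↭∷ (∈-↭∷ nonzeros↭ (∈-nonzeros (-≢0 e≢0)) (-x≢x e≢0))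
      with uR₂ , pairedR₂ ← removeRoots e≢0 e²≡a nonzeros↭ R₁↭
      with m , len≡m+m , Π≡ ← Product.fold-PairedBy _ refl uR₂ pairedR₂
      = begin
        Product.fold nonzeros                 ≡⟨ Product.fold-↭ nonzeros↭ ⟩
        e * Product.fold R₁                   ≡⟨ cong (e *_) (Product.fold-↭ R₁↭) ⟩
        e * (- e * Product.fold R₂)           ≡⟨ cong (λ x → e * (- e * x)) (trans Π≡ (times≡pow m a)) ⟩
        e * (- e * pow a m)          ≡⟨ solve 2 (λ e x → e :* (:- e :* x) := :- ((e :* e) :* x)) refl e (pow a m) ⟩
        - ((e * e) * pow a m)        ≡⟨ cong (λ x → - (x * pow a m)) e²≡a ⟩
        - pow a (suc m)              ≡⟨ cong (λ k → - pow a k) (sym (h≡ {m = suc m} refl length≡)) ⟩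
        - pow a h                    ∎
      where
      open ≡-Reasoning
      length≡ : length nonzeros ≡ suc m +ℕ suc m
      length≡ = trans (↭-length nonzeros↭) (cong suc (trans (↭-length R₁↭)
                  (trans (cong suc len≡m+m) (sym (ℕ.+-suc m m)))))

  1≢0 : 1# ≢ 0#
  1≢0 1≡0 = 0≢1 (sym 1≡0)

  product-nonzeros≡-1 : Product.fold nonzeros ≡ - 1#
  product-nonzeros≡-1 = trans (PairingWith.product-nonzeros-square 1# 1≢0 1≢0 (*-identityˡ 1#)) (cong -_ (pow-1# h))

  C₀⇒≢0 : ∀ {a} → C₀ a → a ≢ 0#
  C₀⇒≢0 (e , e≢0 , e²≡a) a≡0 = *-≢0 e≢0 e≢0 (trans e²≡a a≡0)

  euler-C₀ : ∀ {a} → C₀ a → η a ≡ 1#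
  euler-C₀ {a} a∈C₀@(e , e≢0 , e²≡a) = +G.⁻¹-injective
    (trans (sym (PairingWith.product-nonzeros-square a (C₀⇒≢0 a∈C₀) e≢0 e²≡a)) product-nonzeros≡-1)

  euler-C₁ : ∀ {a} → C₁ a → η a ≡ - 1#
  euler-C₁ {a} (a≢0 , a∉C₀) = trans (sym (PairingWith.product-nonzeros-nonsquare a a≢0 a∉C₀)) product-nonzeros≡-1

  C₀? : ∀ a → Dec (C₀ a)
  C₀? a = map′ Any.satisfied (λ (e , e≢0×e²≡a) → lose (∈-elements e) e≢0×e²≡a)
                (Any.any? (λ e → ¬? (e ≟ 0#) ×-dec ((e * e) ≟ a)) elements)

  C₀⊎C₁ : ∀ {a} → a ≢ 0# → C₀ a ⊎ C₁ a
  C₀⊎C₁ {a} a≢0 with C₀? a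
  ... | yes a∈C₀ = inj₁ a∈C₀
  ... | no  a∉C₀ = inj₂ (a≢0 , a∉C₀)

  η-±1 : ∀ {a} → a ≢ 0# → η a ≡ 1# ⊎ η a ≡ - 1#
  η-±1 a≢0 with C₀⊎C₁ a≢0
  ... | inj₁ a∈C₀ = inj₁ (euler-C₀ a∈C₀)
  ... | inj₂ a∈C₁ = inj₂ (euler-C₁ a∈C₁)

  η²≡1 : ∀ {a} → a ≢ 0# → η a * η a ≡ 1#
  η²≡1 a≢0 with η-±1 a≢0
  ... | inj₁ ηa≡1  rewrite ηa≡1  = *-identityˡ 1#
  ... | inj₂ ηa≡-1 rewrite ηa≡-1 = solve 0 (:- con 1₃ :* :- con 1₃ := con 1₃) refl

  η-⁻¹ : ∀ {a} → a ≢ 0# → η (a ⁻¹) ≡ η a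
  η-⁻¹ {a} a≢0 = begin
    η (a ⁻¹)                   ≡⟨ sym (*-identityʳ _) ⟩
    η (a ⁻¹) * 1#              ≡⟨ cong (η (a ⁻¹) *_) (sym (η²≡1 a≢0)) ⟩
    η (a ⁻¹) * (η a * η a)     ≡⟨ sym (*-assoc _ _ _) ⟩
    η (a ⁻¹) * η a * η a       ≡⟨ cong (_* η a) (sym (η-* (a ⁻¹) a)) ⟩
    η (a ⁻¹ * a) * η a         ≡⟨ cong (λ x → η x * η a) (inverseˡ a a≢0) ⟩
    η 1# * η a                 ≡⟨ cong (_* η a) (pow-1# h) ⟩
    1# * η a                   ≡⟨ *-identityˡ _ ⟩
    η a                        ∎
    where open ≡-Reasoning

  HasEta⇒η≡ : ∀ {a s} → HasEta a s → η a ≡ s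
  HasEta⇒η≡ (inj₁ (a∈C₀ , s≡1))  = trans (euler-C₀ a∈C₀) (sym s≡1)
  HasEta⇒η≡ (inj₂ (a∈C₁ , s≡-1)) = trans (euler-C₁ a∈C₁) (sym s≡-1)

module Telescoping {n : ℕ} (F : FiniteField3 n) where
  open FiniteField3 F
  open FieldProperties F
  open EulerCriterion F using (h)
  open Characteristic3Solver commutativeRing 1+1+1≡0

  Σ< : ℕ → (ℕ → Carrier) → Carrier
  Σ< m f = sumL (applyUpTo f m)

  Σ<-cong : ∀ m {f g} → (∀ j → f j ≡ g j) → Σ< m f ≡ Σ< m g
  Σ<-cong zero    f≗g = refl
  Σ<-cong (suc m) f≗g = cong₂ _+_ (f≗g 0) (Σ<-cong m (λ j → f≗g (suc j)))

  Σ<-*ˡ : ∀ m c f → Σ< m (λ j → c * f j) ≡ c * Σ< m f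
  Σ<-*ˡ zero    c f = sym (zeroʳ c)
  Σ<-*ˡ (suc m) c f = trans (cong (c * f 0 +_) (Σ<-*ˡ m c (λ j → f (suc j)))) (sym (distribˡ _ _ _))

  Σ<-0 : ∀ m → Σ< m (λ _ → 0#) ≡ 0#
  Σ<-0 zero    = refl
  Σ<-0 (suc m) = trans (+-identityˡ _) (Σ<-0 m)

  Σ<-telescope : ∀ m (G : ℕ → Carrier) → Σ< m (λ j → G (suc j) + - G j) ≡ G m + - G 0
  Σ<-telescope zero    G = sym (-‿inverseʳ (G 0))
  Σ<-telescope (suc m) G = trans (cong ((G 1 + - G 0) +_) (Σ<-telescope m (λ j → G (suc j))))
    (solve 3 (λ a b c → (b :- a) :+ (c :- b) := c :- a) refl (G 0) (G 1) (G (suc m)))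

  sum2≡ΣΣ : ∀ f → sum2 f ≡ Σ< n (λ j → Σ< n (f j))
  sum2≡ΣΣ f = begin
    sumL (concat rows)                              ≡⟨ Sum.fold-concat rows ⟩
    sumL (map sumL rows)                            ≡⟨ cong sumL (map-∘ (upTo n)) ⟨
    sumL (map (λ j → sumL (map (f j) (upTo n))) (upTo n))
                                                    ≡⟨ cong sumL (map-applyUpTo (λ j → j) _ n) ⟩
    Σ< n (λ j → sumL (map (f j) (upTo n)))          ≡⟨ Σ<-cong n (λ j → cong sumL (map-applyUpTo (λ k → k) (f j) n)) ⟩
    Σ< n (λ j → Σ< n (f j))                         ∎
    where
    open ≡-Reasoning
    rows = map (λ j → map (f j) (upTo n)) (upTo n)

  corners : ℕ → (ℕ → ℕ → Carrier) → Carrier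
  corners m A = (A m m + - A 0 m) + - (A m 0 + - A 0 0)

  corners-cong : ∀ m {A B} → (∀ j k → A j k ≡ B j k) → corners m A ≡ corners m B
  corners-cong m A≗B = cong₂ (λ x y → x + - y)
    (cong₂ (λ x y → x + - y) (A≗B m m) (A≗B 0 m)) (cong₂ (λ x y → x + - y) (A≗B m 0) (A≗B 0 0))

  Δ² : (ℕ → ℕ → Carrier) → ℕ → ℕ → Carrier
  Δ² A j k = (A (suc j) (suc k) + - A j (suc k)) + - (A (suc j) k + - A j k)

  ΣΣ-Δ² : ∀ m A → Σ< m (λ j → Σ< m (Δ² A j)) ≡ corners m A
  ΣΣ-Δ² m A = begin
    Σ< m (λ j → Σ< m (Δ² A j))
      ≡⟨ Σ<-cong m (λ j → Σ<-telescope m (λ k → A (suc j) k + - A j k)) ⟩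
    Σ< m (λ j → (A (suc j) m + - A j m) + - (A (suc j) 0 + - A j 0))
      ≡⟨ Σ<-cong m (λ j → swap-middle (A (suc j) m) (A j m) (A (suc j) 0) (A j 0)) ⟩
    Σ< m (λ j → C (suc j) + - C j)
      ≡⟨ Σ<-telescope m C ⟩
    C m + - C 0
      ≡⟨ swap-middle (A m m) (A m 0) (A 0 m) (A 0 0) ⟩
    corners m A ∎
    where
    open ≡-Reasoning
    C : ℕ → Carrier
    C j = A j m + - A j 0
    swap-middle : ∀ a b c d → (a + - b) + - (c + - d) ≡ (a + - c) + - (b + - d)
    swap-middle = solve 4 (λ a b c d → (a :- b) :- (c :- d) := (a :- c) :- (b :- d)) refl

  pow-3* : ∀ x m → pow x (3 *ℕ m) ≡ pow x m * (pow x m * pow x m)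
  pow-3* x m = trans (pow-+ x m (m +ℕ (m +ℕ 0)))
    (cong (pow x m *_) (trans (pow-+ x m (m +ℕ 0)) (cong (λ k → pow x m * pow x k) (ℕ.+-identityʳ m))))

  frobenius : ∀ x j → pow (x + - 1#) (3 ^ℕ j) ≡ pow x (3 ^ℕ j) + - 1#
  frobenius x zero    = solve 1 (λ x → (x :- con 1₃) :* con 1₃ := x :* con 1₃ :- con 1₃) refl x
  frobenius x (suc j) = begin
    pow (x + - 1#) (3 *ℕ 3 ^ℕ j)               ≡⟨ pow-3* (x + - 1#) (3 ^ℕ j) ⟩
    Y * (Y * Y)                                ≡⟨ cong (λ y → y * (y * y)) (frobenius x j) ⟩
    (X + - 1#) * ((X + - 1#) * (X + - 1#))     ≡⟨ solve 1 (λ X → (X :- con 1₃) :* ((X :- con 1₃) :* (X :- con 1₃))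
                                                              := X :* (X :* X) :- con 1₃) refl X ⟩
    X * (X * X) + - 1#                         ≡⟨ cong (_+ - 1#) (sym (pow-3* x (3 ^ℕ j))) ⟩
    pow x (3 *ℕ 3 ^ℕ j) + - 1#                 ∎
    where
    open ≡-Reasoning
    X = pow x (3 ^ℕ j)
    Y = pow (x + - 1#) (3 ^ℕ j)

  module _ (z : Carrier) where
    private
      A : ℕ → ℕ → Carrier
      A j k = pow z (exponent j k)

      A-sucˡ : ∀ j k → A (suc j) k ≡ A j k * pow z (3 ^ℕ j)
      A-sucˡ j k = trans (cong (pow z) (exponent-sucˡ j k)) (pow-+ z (exponent j k) (3 ^ℕ j))

      A-sucʳ : ∀ j k → A j (suc k) ≡ A j k * pow z (3 ^ℕ k)
      A-sucʳ j k = trans (cong (pow z) (exponent-sucʳ j k)) (pow-+ z (exponent j k) (3 ^ℕ k))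

      A≡ : ∀ j k → A j k ≡ z * (pow z ⌊3^ j /2⌋ * pow z ⌊3^ k /2⌋)
      A≡ j k = cong (z *_) (pow-+ z ⌊3^ j /2⌋ ⌊3^ k /2⌋)

      pow-cubic≡Δ² : ∀ j k → pow (z * ((z + - 1#) * (z + - 1#))) (exponent j k) ≡ Δ² A j k
      pow-cubic≡Δ² j k = begin
        pow (z * ((z + - 1#) * (z + - 1#))) e
          ≡⟨ pow-distrib-* z _ e ⟩
        a * pow ((z + - 1#) * (z + - 1#)) e
          ≡⟨ cong (a *_) (trans (pow-distrib-* _ _ e) (sym (pow-+ _ e e))) ⟩
        a * pow (z + - 1#) (e +ℕ e)
          ≡⟨ cong (λ m → a * pow (z + - 1#) m) (exponent+exponent j k) ⟩
        a * pow (z + - 1#) (3 ^ℕ j +ℕ 3 ^ℕ k)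
          ≡⟨ cong (a *_) (trans (pow-+ _ (3 ^ℕ j) (3 ^ℕ k)) (cong₂ _*_ (frobenius z j) (frobenius z k))) ⟩
        a * ((u + - 1#) * (v + - 1#))
          ≡⟨ solve 3 (λ a u v → a :* ((u :- con 1₃) :* (v :- con 1₃))
                                := ((a :* v) :* u :- a :* v) :- (a :* u :- a)) refl a u v ⟩
        ((a * v) * u + - (a * v)) + - (a * u + - a)
          ≡⟨ cong₂ (λ x y → (x + - y) + - (a * u + - a))
                   (trans (A-sucˡ j (suc k)) (cong (_* u) (A-sucʳ j k))) (A-sucʳ j k) ⟨
        (A (suc j) (suc k) + - A j (suc k)) + - (a * u + - a)
          ≡⟨ cong (λ x → (A (suc j) (suc k) + - A j (suc k)) + - (x + - a)) (A-sucˡ j k) ⟨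
        Δ² A j k ∎
        where
        open ≡-Reasoning
        e = exponent j k
        a = A j k
        u = pow z (3 ^ℕ j)
        v = pow z (3 ^ℕ k)

    sum2-pow-z[z-1]²≡z : pow z h ≡ - 1# →
              sum2 (λ j k → pow (z * ((z + - 1#) * (z + - 1#))) ((3 ^ℕ j +ℕ 3 ^ℕ k) / 2)) ≡ z
    sum2-pow-z[z-1]²≡z z^h≡-1 = begin
      sum2 (λ j k → pow t ((3 ^ℕ j +ℕ 3 ^ℕ k) / 2))    ≡⟨ sum2≡ΣΣ _ ⟩
      Σ< n (λ j → Σ< n (λ k → pow t ((3 ^ℕ j +ℕ 3 ^ℕ k) / 2)))
        ≡⟨ Σ<-cong n (λ j → Σ<-cong n (λ k → trans (cong (pow t) ([3^j+3^k]/2≡exponent j k)) (pow-cubic≡Δ² j k))) ⟩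
      Σ< n (λ j → Σ< n (Δ² A j))                        ≡⟨ ΣΣ-Δ² n A ⟩
      corners n A                                        ≡⟨ corners-cong n A≡ ⟩
      corners n (λ j k → z * (pow z ⌊3^ j /2⌋ * pow z ⌊3^ k /2⌋))
        ≡⟨ cong (λ p → (z * (p * p) + - (z * (1# * p))) + - (z * (p * 1#) + - (z * (1# * 1#)))) z^⌊3^n/2⌋≡-1 ⟩
      (z * (- 1# * - 1#) + - (z * (1# * - 1#))) + - (z * (- 1# * 1#) + - (z * (1# * 1#)))
        ≡⟨ solve 1 (λ z → (z :* (:- con 1₃ :* :- con 1₃) :- z :* (con 1₃ :* :- con 1₃))
                           :- (z :* (:- con 1₃ :* con 1₃) :- z :* (con 1₃ :* con 1₃)) := z) refl z ⟩
      z ∎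
      where
      open ≡-Reasoning
      t = z * ((z + - 1#) * (z + - 1#))
      z^⌊3^n/2⌋≡-1 : pow z ⌊3^ n /2⌋ ≡ - 1#
      z^⌊3^n/2⌋≡-1 = trans (cong (pow z) (sym ([3^n∸1]/2≡⌊3^n/2⌋ n))) z^h≡-1

module CubicInversion {n : ℕ} (F : FiniteField3 n) where
  open FiniteField3 F
  open FieldProperties F
  open EulerCriterion F
  open Telescoping F
  open Characteristic3Solver commutativeRing 1+1+1≡0

  cubic : Carrier → Carrier → Carrier
  cubic b x = pow x 3 + b * pow x 2 + pow b 2 * x

  cubic≡x[x-b]² : ∀ b x → cubic b x ≡ x * ((x + - b) * (x + - b))
  cubic≡x[x-b]² = solve 2 (λ b x → x :* (x :* (x :* con 1₃)) :+ b :* (x :* (x :* con 1₃)) :+ (b :* (b :* con 1₃)) :* x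
                               := x :* ((x :- b) :* (x :- b))) refl

  cubic-b-b≡0 : ∀ b → cubic b b ≡ 0#
  cubic-b-b≡0 b = trans (cubic≡x[x-b]² b b) (solve 1 (λ b → b :* ((b :- b) :* (b :- b)) := con 0₃) refl b)

  η-*cubic : ∀ a b x → x ≢ b → η (a * cubic b x) ≡ η a * η x
  η-*cubic a b x x≢b = begin
    η (a * cubic b x)                    ≡⟨ cong (λ y → η (a * y)) (cubic≡x[x-b]² b x) ⟩
    η (a * (x * ((x + - b) * (x + - b)))) ≡⟨ trans (η-* a _) (cong (η a *_) (η-* x _)) ⟩
    η a * (η x * η ((x + - b) * (x + - b))) ≡⟨ cong (λ y → η a * (η x * y)) (euler-C₀ (x + - b , x-b≢0 , refl)) ⟩
    η a * (η x * 1#)                     ≡⟨ cong (η a *_) (*-identityʳ _) ⟩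
    η a * η x                            ∎
    where
    open ≡-Reasoning
    x-b≢0 : x + - b ≢ 0#
    x-b≢0 x-b≡0 = x≢b (y-e≡0⇒y≡e x-b≡0)

  cubicInverse : Carrier → Carrier → Carrier → Carrier
  cubicInverse a b y = sum2 (λ j k → b * pow ((a ⁻¹) * pow (b ⁻¹) 3 * y) ((3 ^ℕ j +ℕ 3 ^ℕ k) / 2))

  sum2-*ˡ : ∀ c f → sum2 (λ j k → c * f j k) ≡ c * sum2 f
  sum2-*ˡ c f = begin
    sum2 (λ j k → c * f j k)                ≡⟨ sum2≡ΣΣ _ ⟩
    Σ< n (λ j → Σ< n (λ k → c * f j k))    ≡⟨ Σ<-cong n (λ j → Σ<-*ˡ n c (f j)) ⟩
    Σ< n (λ j → c * Σ< n (f j))            ≡⟨ Σ<-*ˡ n c _ ⟩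
    c * Σ< n (λ j → Σ< n (f j))            ≡⟨ cong (c *_) (sym (sum2≡ΣΣ f)) ⟩
    c * sum2 f                              ∎
    where open ≡-Reasoning

  cubicInverse-0 : ∀ a b → cubicInverse a b 0# ≡ 0#
  cubicInverse-0 a b = begin
    cubicInverse a b 0#                    ≡⟨ sum2≡ΣΣ _ ⟩
    Σ< n (λ j → Σ< n (λ k → b * pow c (E j k))) ≡⟨ Σ<-cong n (λ j → Σ<-cong n (λ k → term≡0 j k)) ⟩
    Σ< n (λ j → Σ< n (λ _ → 0#))           ≡⟨ Σ<-cong n (λ _ → Σ<-0 n) ⟩
    Σ< n (λ _ → 0#)                        ≡⟨ Σ<-0 n ⟩
    0#                                     ∎
    where
    open ≡-Reasoning
    c = (a ⁻¹) * pow (b ⁻¹) 3 * 0#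
    E = λ j k → (3 ^ℕ j +ℕ 3 ^ℕ k) / 2
    term≡0 : ∀ j k → b * pow c (E j k) ≡ 0#
    term≡0 j k rewrite [3^j+3^k]/2≡exponent j k | zeroʳ ((a ⁻¹) * pow (b ⁻¹) 3) =
      trans (cong (b *_) (zeroˡ _)) (zeroʳ b)

  cubicInverse-inverts : ∀ {a b} x → a ≢ 0# → b ≢ 0# → η (x * b ⁻¹) ≡ - 1# →
                         cubicInverse a b (a * cubic b x) ≡ x
  cubicInverse-inverts {a} {b} x a≢0 b≢0 η-z≡-1 = begin
    cubicInverse a b (a * cubic b x)
      ≡⟨ cong (λ y → sum2 (λ j k → b * pow y ((3 ^ℕ j +ℕ 3 ^ℕ k) / 2))) rescale ⟩
    sum2 (λ j k → b * pow (z * ((z + - 1#) * (z + - 1#))) ((3 ^ℕ j +ℕ 3 ^ℕ k) / 2))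
      ≡⟨ sum2-*ˡ b _ ⟩
    b * sum2 (λ j k → pow (z * ((z + - 1#) * (z + - 1#))) ((3 ^ℕ j +ℕ 3 ^ℕ k) / 2))
      ≡⟨ cong (b *_) (sum2-pow-z[z-1]²≡z z η-z≡-1) ⟩
    b * (x * b ⁻¹)
      ≡⟨ solve 3 (λ b x b⁻¹ → b :* (x :* b⁻¹) := x :* (b :* b⁻¹)) refl b x (b ⁻¹) ⟩
    x * (b * b ⁻¹)
      ≡⟨ cong (x *_) (inverseʳ b b≢0) ⟩
    x * 1#
      ≡⟨ *-identityʳ x ⟩
    x ∎
    where
    open ≡-Reasoning
    z = x * b ⁻¹
    rescale : (a ⁻¹) * pow (b ⁻¹) 3 * (a * cubic b x) ≡ z * ((z + - 1#) * (z + - 1#))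
    rescale = begin
      (a ⁻¹) * pow (b ⁻¹) 3 * (a * cubic b x)
        ≡⟨ cong (λ y → (a ⁻¹) * pow (b ⁻¹) 3 * (a * y)) (cubic≡x[x-b]² b x) ⟩
      (a ⁻¹) * pow (b ⁻¹) 3 * (a * (x * ((x + - b) * (x + - b))))
        ≡⟨ solve 5 (λ a a⁻¹ b b⁻¹ x →
                    a⁻¹ :* (b⁻¹ :* (b⁻¹ :* (b⁻¹ :* con 1₃))) :* (a :* (x :* ((x :- b) :* (x :- b))))
                    := (a :* a⁻¹) :* ((x :* b⁻¹) :* ((x :* b⁻¹ :- b :* b⁻¹) :* (x :* b⁻¹ :- b :* b⁻¹))))
                 refl a (a ⁻¹) b (b ⁻¹) x ⟩
      (a * a ⁻¹) * (z * ((z + - (b * b ⁻¹)) * (z + - (b * b ⁻¹))))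
        ≡⟨ cong₂ (λ u v → u * (z * ((z + - v) * (z + - v)))) (inverseʳ a a≢0) (inverseʳ b b≢0) ⟩
      1# * (z * ((z + - 1#) * (z + - 1#)))
        ≡⟨ *-identityˡ _ ⟩
      z * ((z + - 1#) * (z + - 1#)) ∎

module Inversion {n : ℕ} (F : FiniteField3 n) where
  open FiniteField3 F
  open FieldProperties F
  open EulerCriterion F
  open CubicInversion F
  open Characteristic3Solver commutativeRing 1+1+1≡0

  module Piecewise
    (α β γ θ : Carrier) (α≢0 : α ≢ 0#) (β≢0 : β ≢ 0#) (γ≢0 : γ ≢ 0#) (θ≢0 : θ ≢ 0#)
    (f : Carrier → Carrier) (f-0 : f 0# ≡ 0#)
    (f-C₀ : ∀ x → C₀ x → f x ≡ α * cubic γ x) (f-C₁ : ∀ x → C₁ x → f x ≡ β * cubic θ x)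
    (f-bijective : Bijective _≡_ _≡_ f) (m : ℕ) (η-α : HasEta α (pow (- 1#) m))
    where

    preimage : ∀ y → ∃ λ x → f x ≡ y
    preimage y = proj₁ (proj₂ f-bijective y) , proj₂ (proj₂ f-bijective y) refl

    private
      f-injective : ∀ {x y} → f x ≡ f y → x ≡ y
      f-injective = proj₁ f-bijective

      1≢-1 : 1# ≢ - 1#
      1≢-1 1≡-1 = -x≢x 1≢0 (sym 1≡-1)

    η-γ≡-1 : η γ ≡ - 1#
    η-γ≡-1 with C₀⊎C₁ γ≢0
    ... | inj₁ γ∈C₀ = contradiction (f-injective (trans (f-C₀ γ γ∈C₀)
                        (trans (cong (α *_) (cubic-b-b≡0 γ)) (trans (zeroʳ α) (sym f-0))))) γ≢0
    ... | inj₂ γ∈C₁ = euler-C₁ γ∈C₁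

    η-θ≡1 : η θ ≡ 1#
    η-θ≡1 with C₀⊎C₁ θ≢0
    ... | inj₁ θ∈C₀ = euler-C₀ θ∈C₀
    ... | inj₂ θ∈C₁ = contradiction (f-injective (trans (f-C₁ θ θ∈C₁)
                        (trans (cong (β *_) (cubic-b-b≡0 θ)) (trans (zeroʳ β) (sym f-0))))) θ≢0

    η-f-C₀ : ∀ {x} → C₀ x → η (f x) ≡ η α
    η-f-C₀ {x} x∈C₀ = begin
      η (f x)           ≡⟨ cong η (f-C₀ x x∈C₀) ⟩
      η (α * cubic γ x) ≡⟨ η-*cubic α γ x x≢γ ⟩
      η α * η x         ≡⟨ cong (η α *_) (euler-C₀ x∈C₀) ⟩
      η α * 1#          ≡⟨ *-identityʳ _ ⟩
      η α               ∎
      where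
      open ≡-Reasoning
      x≢γ : x ≢ γ
      x≢γ x≡γ = 1≢-1 (trans (sym (euler-C₀ x∈C₀)) (trans (cong η x≡γ) η-γ≡-1))

    η-f-C₁ : ∀ {x} → C₁ x → η (f x) ≡ - η β
    η-f-C₁ {x} x∈C₁ = begin
      η (f x)           ≡⟨ cong η (f-C₁ x x∈C₁) ⟩
      η (β * cubic θ x) ≡⟨ η-*cubic β θ x x≢θ ⟩
      η β * η x         ≡⟨ cong (η β *_) (euler-C₁ x∈C₁) ⟩
      η β * - 1#        ≡⟨ solve 1 (λ y → y :* :- con 1₃ := :- y) refl (η β) ⟩
      - η β             ∎
      where
      open ≡-Reasoning
      x≢θ : x ≢ θ
      x≢θ x≡θ = 1≢-1 (trans (sym η-θ≡1) (trans (cong η (sym x≡θ)) (euler-C₁ x∈C₁)))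

    η-f : ∀ {x} → x ≢ 0# → η (f x) ≡ η α ⊎ η (f x) ≡ - η β
    η-f x≢0 with C₀⊎C₁ x≢0
    ... | inj₁ x∈C₀ = inj₁ (η-f-C₀ x∈C₀)
    ... | inj₂ x∈C₁ = inj₂ (η-f-C₁ x∈C₁)

    private
      η-value : ∀ {y} → y ≢ 0# → η y ≡ η α ⊎ η y ≡ - η β
      η-value {y} y≢0 with x , fx≡y ← preimage y = subst (λ z → η z ≡ η α ⊎ η z ≡ - η β) fx≡y (η-f x≢0)
        where
        x≢0 : x ≢ 0#
        x≢0 x≡0 = y≢0 (trans (sym fx≡y) (trans (cong f x≡0) f-0))

    -- Since f is onto, both 1 and the non-square γ have preimages.
    η-β≡η-α : η β ≡ η α
    η-β≡η-α with η-±1 α≢0 | η-value γ≢0 | η-value 1≢0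
    ... | inj₁ ηα≡1  | inj₁ ηγ≡ηα  | _ = contradiction (trans (sym ηα≡1) (trans (sym ηγ≡ηα) η-γ≡-1)) 1≢-1
    ... | inj₁ ηα≡1  | inj₂ ηγ≡-ηβ | _ = trans (+G.⁻¹-injective (trans (sym ηγ≡-ηβ) η-γ≡-1)) (sym ηα≡1)
    ... | inj₂ ηα≡-1 | _ | inj₁ η1≡ηα  = contradiction (trans (sym (pow-1# h)) (trans η1≡ηα ηα≡-1)) 1≢-1
    ... | inj₂ ηα≡-1 | _ | inj₂ η1≡-ηβ =
      trans (+G.⁻¹-injective (trans (sym η1≡-ηβ) (trans (pow-1# h) (sym (+G.⁻¹-involutive 1#))))) (sym ηα≡-1)

    u v g : Carrier → Carrier
    u = cubicInverse α γ
    v = cubicInverse β θ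
    g y = (- (u y * (1# + pow (- 1#) m * pow y h))) + (- (v y * (1# + pow (- 1#) (m +ℕ 1) * pow y h)))

    private
      s : Carrier
      s = pow (- 1#) m

      s≡η-α : s ≡ η α
      s≡η-α = sym (HasEta⇒η≡ η-α)

      s*s≡1 : s * s ≡ 1#
      s*s≡1 = begin
        s * s                   ≡⟨ sym (pow-distrib-* (- 1#) (- 1#) m) ⟩
        pow (- 1# * - 1#) m     ≡⟨ cong (λ x → pow x m) (solve 0 (:- con 1₃ :* :- con 1₃ := con 1₃) refl) ⟩
        pow 1# m                ≡⟨ pow-1# m ⟩
        1#                      ∎
        where open ≡-Reasoning

      select : Carrier → Carrier → Carrier → Carrier
      select w U V = (- (U * (1# + w))) + (- (V * (1# + - w)))

      select-1 : ∀ U V → select 1# U V ≡ U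
      select-1 = solve 2 (λ U V → (:- (U :* (con 1₃ :+ con 1₃))) :+ (:- (V :* (con 1₃ :+ :- con 1₃))) := U) refl

      select--1 : ∀ U V → select (- 1#) U V ≡ V
      select--1 = solve 2 (λ U V → (:- (U :* (con 1₃ :+ :- con 1₃))) :+ (:- (V :* (con 1₃ :+ :- (:- con 1₃)))) := V) refl

      g≡select : ∀ y → g y ≡ select (s * η y) (u y) (v y)
      g≡select y = cong (λ t → (- (u y * (1# + s * η y))) + (- (v y * (1# + t)))) (begin
        pow (- 1#) (m +ℕ 1) * η y     ≡⟨ cong (_* η y) (pow-+ (- 1#) m 1) ⟩
        s * (- 1# * 1#) * η y         ≡⟨ solve 2 (λ s w → s :* (:- con 1₃ :* con 1₃) :* w := :- (s :* w)) refl s (η y) ⟩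
        - (s * η y)                   ∎)
        where open ≡-Reasoning

    g-on-η≡η-α : ∀ {y} → η y ≡ η α → g y ≡ u y
    g-on-η≡η-α {y} ηy≡ηα = begin
      g y                          ≡⟨ g≡select y ⟩
      select (s * η y) (u y) (v y) ≡⟨ cong (λ w → select (s * w) (u y) (v y)) (trans ηy≡ηα (sym s≡η-α)) ⟩
      select (s * s) (u y) (v y)   ≡⟨ cong (λ w → select w (u y) (v y)) s*s≡1 ⟩
      select 1# (u y) (v y)        ≡⟨ select-1 (u y) (v y) ⟩
      u y                          ∎
      where open ≡-Reasoning

    g-on-η≡-η-α : ∀ {y} → η y ≡ - η α → g y ≡ v y
    g-on-η≡-η-α {y} ηy≡-ηα = begin
      g y                            ≡⟨ g≡select y ⟩
      select (s * η y) (u y) (v y)   ≡⟨ cong (λ w → select (s * w) (u y) (v y)) (trans ηy≡-ηα (cong -_ (sym s≡η-α))) ⟩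
      select (s * - s) (u y) (v y)   ≡⟨ cong (λ w → select w (u y) (v y)) s*-s≡-1 ⟩
      select (- 1#) (u y) (v y)      ≡⟨ select--1 (u y) (v y) ⟩
      v y                            ∎
      where
      open ≡-Reasoning
      s*-s≡-1 : s * - s ≡ - 1#
      s*-s≡-1 = trans (solve 1 (λ s → s :* :- s := :- (s :* s)) refl s) (cong -_ s*s≡1)

    g-0 : g 0# ≡ 0#
    g-0 = begin
      g 0#                             ≡⟨ g≡select 0# ⟩
      select (s * η 0#) (u 0#) (v 0#)  ≡⟨ cong₂ (select (s * η 0#)) (cubicInverse-0 α γ) (cubicInverse-0 β θ) ⟩
      select (s * η 0#) 0# 0#          ≡⟨ solve 1 (λ w → (:- (con 0₃ :* (con 1₃ :+ w))) :+ (:- (con 0₃ :* (con 1₃ :+ :- w)))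
                                                       := con 0₃) refl (s * η 0#) ⟩
      0#                               ∎
      where open ≡-Reasoning

    g∘f-C₀ : ∀ {x} → C₀ x → g (f x) ≡ x
    g∘f-C₀ {x} x∈C₀ = begin
      g (f x)      ≡⟨ g-on-η≡η-α (η-f-C₀ x∈C₀) ⟩
      u (f x)      ≡⟨ cong u (f-C₀ x x∈C₀) ⟩
      u (α * cubic γ x) ≡⟨ cubicInverse-inverts x α≢0 γ≢0 η-x/γ≡-1 ⟩
      x            ∎
      where
      open ≡-Reasoning
      η-x/γ≡-1 : η (x * γ ⁻¹) ≡ - 1#
      η-x/γ≡-1 = trans (η-* x _) (trans (cong₂ _*_ (euler-C₀ x∈C₀) (trans (η-⁻¹ γ≢0) η-γ≡-1)) (*-identityˡ _))

    g∘f-C₁ : ∀ {x} → C₁ x → g (f x) ≡ x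
    g∘f-C₁ {x} x∈C₁ = begin
      g (f x)      ≡⟨ g-on-η≡-η-α (trans (η-f-C₁ x∈C₁) (cong -_ η-β≡η-α)) ⟩
      v (f x)      ≡⟨ cong v (f-C₁ x x∈C₁) ⟩
      v (β * cubic θ x) ≡⟨ cubicInverse-inverts x β≢0 θ≢0 η-x/θ≡-1 ⟩
      x            ∎
      where
      open ≡-Reasoning
      η-x/θ≡-1 : η (x * θ ⁻¹) ≡ - 1#
      η-x/θ≡-1 = trans (η-* x _) (trans (cong₂ _*_ (euler-C₁ x∈C₁) (trans (η-⁻¹ θ≢0) η-θ≡1)) (*-identityʳ _))

theorem7 : (n : ℕ) → 1 ≤ n → (F : FiniteField3 n) →
  let open FiniteField3 F in
  (α β γ θ : Carrier) → α ≢ 0# → β ≢ 0# → γ ≢ 0# → θ ≢ 0# →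
  (f : Carrier → Carrier) →
  f 0# ≡ 0# →
  (∀ x → C₀ x → f x ≡ α * (pow x 3 + γ * pow x 2 + pow γ 2 * x)) →
  (∀ x → C₁ x → f x ≡ β * (pow x 3 + θ * pow x 2 + pow θ 2 * x)) →
  Bijective _≡_ _≡_ f →
  (m : ℕ) → (m ≡ 0 ⊎ m ≡ 1) → HasEta α (pow (- 1#) m) →
  let h = (3 ^ℕ n ∸ 1) / 2
      u = λ x → sum2 (λ j k → γ * pow ((α ⁻¹) * pow (γ ⁻¹) 3 * x) ((3 ^ℕ j +ℕ 3 ^ℕ k) / 2))
      v = λ x → sum2 (λ j k → θ * pow ((β ⁻¹) * pow (θ ⁻¹) 3 * x) ((3 ^ℕ j +ℕ 3 ^ℕ k) / 2))
      g = λ x → (- (u x * (1# + pow (- 1#) m * pow x h)))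
                + (- (v x * (1# + pow (- 1#) (m +ℕ 1) * pow x h)))
  in (∀ c → g (f c) ≡ c) × (∀ y → f (g y) ≡ y)
theorem7 n _ F α β γ θ α≢0 β≢0 γ≢0 θ≢0 f f-0 f-C₀ f-C₁ f-bijective m _ η-α = g∘f≡id , f∘g≡id
  where
  open FiniteField3 F
  open EulerCriterion F using (C₀⊎C₁)
  open Inversion F
  open Piecewise α β γ θ α≢0 β≢0 γ≢0 θ≢0 f f-0 f-C₀ f-C₁ f-bijective m η-α

  g∘f≡id : ∀ x → g (f x) ≡ x
  g∘f≡id x with x ≟ 0#
  ... | yes refl = trans (cong g f-0) g-0
  ... | no  x≢0 with C₀⊎C₁ x≢0
  ...   | inj₁ x∈C₀ = g∘f-C₀ x∈C₀
  ...   | inj₂ x∈C₁ = g∘f-C₁ x∈C₁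

  f∘g≡id : ∀ y → f (g y) ≡ y
  f∘g≡id y with x , fx≡y ← preimage y =
    trans (cong (f ∘ g) (sym fx≡y)) (trans (cong f (g∘f≡id x)) fx≡y)
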